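{- For every integer $n\ge 0$, $$\sum_{F\in\mathcal{F}(n)}\ \prod_{v\in V(F)}\left(x+\frac{1}{h_v}\right)=\frac{1}{(2n+1)\,n!}\prod_{i=0}^{n-1}\bigl((2n+1-i)x+(2n+1-2i)\bigr).$$
   Context: A plane tree is a rooted tree with unlabelled vertices in which the children of each vertex are linearly ordered. A plane forest is a linearly ordered sequence of plane trees; $\mathcal{F}(n)$ is the set of plane forests with $n$ vertices in total. $V(F)$ is the vertex set of $F$, and for $v\in V(F)$ the hook length $h_v$ is the number of vertices in the subtree rooted at $v$ (including $v$). Empty products equal $1$. -}

module Defs where

open import Data.Nat as ℕ using (ℕ; zero; suc; _∸_; _!)
open import Data.Nat.Properties using (m*n≢0; _!≢0)
open import Data.Integer using (+_)
open import Data.List using (List; []; _∷_; upTo; map)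
open import Data.Rational using (ℚ; _+_; _*_; _/_; 1ℚ; 0ℚ)

-- Plane trees: a root with a linearly ordered list of subtrees.
data Tree : Set where
  node : List Tree → Tree

Forest : Set
Forest = List Tree

mutual
  treeSize : Tree → ℕ
  treeSize (node ts) = suc (forestSize ts)

  forestSize : Forest → ℕ
  forestSize [] = zero
  forestSize (t ∷ ts) = treeSize t ℕ.+ forestSize ts

mutual
  -- ∏_{v ∈ V(T)} (x + 1/h_v) ; the root of node ts has hook length treeSize (node ts)
  treeHookProd : ℚ → Tree → ℚ
  treeHookProd x (node ts) = (x + (+ 1 / suc (forestSize ts))) * forestHookProd x ts

  forestHookProd : ℚ → Forest → ℚ
  forestHookProd x [] = 1ℚ
  forestHookProd x (t ∷ ts) = treeHookProd x t * forestHookProd x ts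

sumℚ : List ℚ → ℚ
sumℚ [] = 0ℚ
sumℚ (q ∷ qs) = q + sumℚ qs

prodℚ : List ℚ → ℚ
prodℚ [] = 1ℚ
prodℚ (q ∷ qs) = q * prodℚ qs

ℕ→ℚ : ℕ → ℚ
ℕ→ℚ k = + k / 1

coeff : ℕ → ℚ
coeff n = (+ 1) / (suc (2 ℕ.* n) ℕ.* (n !))
  where instance _ = m*n≢0 (suc (2 ℕ.* n)) (n !) {{_}} {{n !≢0}}

-- right-hand side: (1/((2n+1) n!)) ∏_{i=0}^{n-1} ((2n+1-i) x + (2n+1-2i))
-- (for i < n both 2n+1-i and 2n+1-2i are positive, so truncated subtraction is exact)
rhs : ℕ → ℚ → ℚ
rhs n x = coeff n * prodℚ (map (λ i → ℕ→ℚ (suc (2 ℕ.* n) ∸ i) * x + ℕ→ℚ (suc (2 ℕ.* n) ∸ 2 ℕ.* i)) (upTo n))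

-- Let F = Σ F_n zⁿ, where F_n sums the hook products over 𝓕(n). Splitting off the first tree
-- gives F = 1 + T F, where T_{k+1} = (x + 1/(k+1)) F_k is the sum over trees with k+1 vertices,
-- so that θT = (x+1) z F + x z θF for the Euler operator θ = z d/dz. Differentiating F = 1 + T F yields θF = F² θT, hence
-- θ(F^{m+1}) = (m+1) F^{m+2} θT, a recurrence for the coefficients of F^{m+1} jointly in n and m.
-- By induction on n it gives
--   (2n+m+1) n! [zⁿ] F^{m+1} = (m+1) ∏_{i<n} ((2n+m+1−i) x + (2n+m+1−2i)),
-- and m = 0 is the theorem.
module Submission where

open import Defs
open import Data.Nat as ℕ using (ℕ; zero; suc; _∸_; _≤_; z≤n; s≤s; _!)
import Data.Nat.Properties as ℕP
open import Data.Integer as ℤ using (+_)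
import Data.Integer.Properties as ℤP
open import Data.Rational using (ℚ; _+_; _*_; _/_; 1ℚ; 0ℚ; toℚᵘ)
import Data.Rational.Properties as ℚP
open import Data.Rational.Unnormalised using (mkℚᵘ; *≡*; _≃_)
import Data.Rational.Unnormalised.Properties as ℚᵘP
open import Data.Rational.Solver using (module +-*-Solver)
open import Algebra.Bundles using (CommutativeMonoid)
open import Algebra.Properties.Group ℚP.+-0-group using (∙-cancelˡ)
open import Algebra.Properties.CommutativeSemigroup
  (CommutativeMonoid.commutativeSemigroup ℚP.+-0-commutativeMonoid)
  using () renaming (interchange to +-interchange)
open import Data.List using (List; []; _∷_; _++_; [_]; map; upTo; foldr; cartesianProductWith)
open import Data.List.Membership.Propositional using (_∈_)
open import Data.List.Membership.Propositional.Properties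
  using (∈-++⁺ˡ; ∈-++⁺ʳ; ∈-++⁻; ∈-map⁺; ∈-map⁻; ∈-cartesianProductWith⁺; ∈-cartesianProductWith⁻)
open import Data.List.Membership.Propositional.Properties.WithK using (unique∧set⇒bag)
open import Data.List.Relation.Binary.BagAndSetEquality using (∼bag⇒↭)
open import Data.List.Relation.Binary.Disjoint.Propositional using (Disjoint)
open import Data.List.Relation.Binary.Permutation.Propositional using (_↭_; ↭⇒↭ₛ)
import Data.List.Relation.Binary.Permutation.Propositional.Properties as ↭ₚ
open import Data.List.Relation.Binary.Permutation.Setoid.Properties using (foldr-commMonoid)
open import Data.List.Relation.Unary.All as All using (All; []; _∷_)
open import Data.List.Relation.Unary.Any using (here)
import Data.List.Relation.Unary.AllPairs as AllPairs
open import Data.List.Relation.Unary.Unique.Propositional using (Unique)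
import Data.List.Relation.Unary.Unique.Propositional.Properties as Uniqueₚ
open import Data.Product using (_×_; _,_; proj₁; ∃₂)
open import Data.Sum using (inj₁; inj₂)
open import Function.Bundles using (_⇔_; mk⇔; Equivalence)
import Data.List.Properties as Listₚ
open import Data.Nat.Tactic.RingSolver using (solve-∀)
open import Function using (_∘_)
open import Relation.Binary.PropositionalEquality
  using (_≡_; refl; sym; trans; cong; cong₂; subst; _≗_; _→-setoid_; module ≡-Reasoning)
import Relation.Binary.Reasoning.Setoid as SetoidReasoning

open +-*-Solver using (solve; _:+_; _:*_; _:=_; con)

toℚᵘ-ℕ→ℚ : ∀ n → toℚᵘ (ℕ→ℚ n) ≃ mkℚᵘ (+ n) 0
toℚᵘ-ℕ→ℚ n = ℚP.toℚᵘ-fromℚᵘ (mkℚᵘ (+ n) 0)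

ℕ→ℚ-+ : ∀ m n → ℕ→ℚ (m ℕ.+ n) ≡ ℕ→ℚ m + ℕ→ℚ n
ℕ→ℚ-+ m n = ℚP.toℚᵘ-injective (ℚᵘP.≃-trans (toℚᵘ-ℕ→ℚ (m ℕ.+ n)) (ℚᵘP.≃-trans (*≡* eq)
  (ℚᵘP.≃-sym (ℚᵘP.≃-trans (ℚP.toℚᵘ-homo-+ (ℕ→ℚ m) (ℕ→ℚ n))
                           (ℚᵘP.+-cong (toℚᵘ-ℕ→ℚ m) (toℚᵘ-ℕ→ℚ n))))))
  where
  eq : + (m ℕ.+ n) ℤ.* + 1 ≡ (+ m ℤ.* + 1 ℤ.+ + n ℤ.* + 1) ℤ.* + 1
  eq = cong (ℤ._* + 1) (trans (ℤP.pos-+ m n)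
         (sym (cong₂ ℤ._+_ (ℤP.*-identityʳ (+ m)) (ℤP.*-identityʳ (+ n)))))

ℕ→ℚ-* : ∀ m n → ℕ→ℚ (m ℕ.* n) ≡ ℕ→ℚ m * ℕ→ℚ n
ℕ→ℚ-* m n = ℚP.toℚᵘ-injective (ℚᵘP.≃-trans (toℚᵘ-ℕ→ℚ (m ℕ.* n)) (ℚᵘP.≃-trans (*≡* eq)
  (ℚᵘP.≃-sym (ℚᵘP.≃-trans (ℚP.toℚᵘ-homo-* (ℕ→ℚ m) (ℕ→ℚ n))
                           (ℚᵘP.*-cong (toℚᵘ-ℕ→ℚ m) (toℚᵘ-ℕ→ℚ n))))))
  where
  eq : + (m ℕ.* n) ℤ.* + 1 ≡ (+ m ℤ.* + n) ℤ.* + 1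
  eq = cong (ℤ._* + 1) (ℤP.pos-* m n)

1/-inverseˡ : ∀ d .{{_ : ℕ.NonZero d}} → (+ 1 / d) * ℕ→ℚ d ≡ 1ℚ
1/-inverseˡ (suc d) = ℚP.toℚᵘ-injective (ℚᵘP.≃-trans (ℚP.toℚᵘ-homo-* (+ 1 / suc d) (ℕ→ℚ (suc d)))
  (ℚᵘP.≃-trans (ℚᵘP.*-cong (ℚP.toℚᵘ-fromℚᵘ (mkℚᵘ (+ 1) d)) (toℚᵘ-ℕ→ℚ (suc d))) (*≡* eq)))
  where
  eq : (+ 1 ℤ.* + suc d) ℤ.* + 1 ≡ + 1 ℤ.* + (suc d ℕ.* 1)
  eq = trans (ℤP.*-identityʳ _) (cong (λ k → + 1 ℤ.* + k) (sym (ℕP.*-identityʳ (suc d))))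

ℕ→ℚ-suc-cancelˡ : ∀ k {p q} → ℕ→ℚ (suc k) * p ≡ ℕ→ℚ (suc k) * q → p ≡ q
ℕ→ℚ-suc-cancelˡ k {p} {q} eq = begin
  p                ≡⟨ sym (scale p) ⟩
  k⁻¹ * (K * p)    ≡⟨ cong (k⁻¹ *_) eq ⟩
  k⁻¹ * (K * q)    ≡⟨ scale q ⟩
  q                ∎
  where
  open ≡-Reasoning
  K k⁻¹ : ℚ
  K = ℕ→ℚ (suc k)
  k⁻¹ = + 1 / suc k
  scale : ∀ r → k⁻¹ * (K * r) ≡ r
  scale r = trans (sym (ℚP.*-assoc k⁻¹ K r))
                  (trans (cong (_* r) (1/-inverseˡ (suc k))) (ℚP.*-identityˡ r))

Series : Set
Series = ℕ → ℚ

module ≈-Reasoning = SetoidReasoning (ℕ →-setoid ℚ)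

infixl 6 _⊕_
infixr 8 _·_
infixl 7 _⋆_
infixr 8 _^_

_⊕_ : Series → Series → Series
(a ⊕ b) n = a n + b n

_·_ : ℚ → Series → Series
(c · a) n = c * a n

𝟘 : Series
𝟘 _ = 0ℚ

𝟙 : Series
𝟙 zero = 1ℚ
𝟙 (suc _) = 0ℚ

_⋆_ : Series → Series → Series
(a ⋆ b) zero = a 0 * b 0
(a ⋆ b) (suc n) = a 0 * b (suc n) + (a ∘ suc ⋆ b) n

_^_ : Series → ℕ → Series
a ^ zero = 𝟙
a ^ suc m = a ⋆ a ^ m

θ : Series → Series
θ a n = ℕ→ℚ n * a n

shift : Series → Series
shift a zero = 0ℚ
shift a (suc n) = a n

⋆-cong-≤ : ∀ {a a′ b b′} n → (∀ i → i ≤ n → a i ≡ a′ i) → (∀ j → j ≤ n → b j ≡ b′ j) →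
           (a ⋆ b) n ≡ (a′ ⋆ b′) n
⋆-cong-≤ zero ea eb = cong₂ _*_ (ea 0 z≤n) (eb 0 z≤n)
⋆-cong-≤ (suc n) ea eb = cong₂ _+_ (cong₂ _*_ (ea 0 z≤n) (eb (suc n) ℕP.≤-refl))
  (⋆-cong-≤ n (λ i i≤n → ea (suc i) (s≤s i≤n)) (λ j j≤n → eb j (ℕP.m≤n⇒m≤1+n j≤n)))

⋆-cong : ∀ {a a′ b b′} → a ≗ a′ → b ≗ b′ → a ⋆ b ≗ a′ ⋆ b′
⋆-cong ea eb n = ⋆-cong-≤ n (λ i _ → ea i) (λ j _ → eb j)

⋆-congˡ : ∀ {a a′} b → a ≗ a′ → a ⋆ b ≗ a′ ⋆ b
⋆-congˡ b ea = ⋆-cong ea (λ _ → refl)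

⋆-congʳ : ∀ a {b b′} → b ≗ b′ → a ⋆ b ≗ a ⋆ b′
⋆-congʳ a eb = ⋆-cong (λ _ → refl) eb

⋆-zeroˡ : ∀ b → 𝟘 ⋆ b ≗ 𝟘
⋆-zeroˡ b zero = ℚP.*-zeroˡ (b 0)
⋆-zeroˡ b (suc n) = trans (cong₂ _+_ (ℚP.*-zeroˡ (b (suc n))) (⋆-zeroˡ b n)) (ℚP.+-identityʳ 0ℚ)

⋆-identityˡ : ∀ a → 𝟙 ⋆ a ≗ a
⋆-identityˡ a zero = ℚP.*-identityˡ (a 0)
⋆-identityˡ a (suc n) =
  trans (cong₂ _+_ (ℚP.*-identityˡ (a (suc n))) (⋆-zeroˡ a n)) (ℚP.+-identityʳ (a (suc n)))

⋆-distribʳ : ∀ a b c → (a ⊕ b) ⋆ c ≗ a ⋆ c ⊕ b ⋆ c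
⋆-distribʳ a b c zero = ℚP.*-distribʳ-+ (c 0) (a 0) (b 0)
⋆-distribʳ a b c (suc n) = trans
  (cong₂ _+_ (ℚP.*-distribʳ-+ (c (suc n)) (a 0) (b 0)) (⋆-distribʳ (a ∘ suc) (b ∘ suc) c n))
  (+-interchange (a 0 * c (suc n)) (b 0 * c (suc n)) ((a ∘ suc ⋆ c) n) ((b ∘ suc ⋆ c) n))

⋆-distribˡ : ∀ a b c → a ⋆ (b ⊕ c) ≗ a ⋆ b ⊕ a ⋆ c
⋆-distribˡ a b c zero = ℚP.*-distribˡ-+ (a 0) (b 0) (c 0)
⋆-distribˡ a b c (suc n) = trans
  (cong₂ _+_ (ℚP.*-distribˡ-+ (a 0) (b (suc n)) (c (suc n))) (⋆-distribˡ (a ∘ suc) b c n))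
  (+-interchange (a 0 * b (suc n)) (a 0 * c (suc n)) ((a ∘ suc ⋆ b) n) ((a ∘ suc ⋆ c) n))

·-⋆-assoc : ∀ k a b → (k · a) ⋆ b ≗ k · (a ⋆ b)
·-⋆-assoc k a b zero = ℚP.*-assoc k (a 0) (b 0)
·-⋆-assoc k a b (suc n) = trans
  (cong₂ _+_ (ℚP.*-assoc k (a 0) (b (suc n))) (·-⋆-assoc k (a ∘ suc) b n))
  (sym (ℚP.*-distribˡ-+ k _ _))

⋆-·-comm : ∀ k a b → a ⋆ (k · b) ≗ k · (a ⋆ b)
⋆-·-comm k a b zero = solve 3 (λ k p q → p :* (k :* q) := k :* (p :* q)) refl k (a 0) (b 0)
⋆-·-comm k a b (suc n) = trans
  (cong₂ _+_ (solve 3 (λ k p q → p :* (k :* q) := k :* (p :* q)) refl k (a 0) (b (suc n)))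
             (⋆-·-comm k (a ∘ suc) b n))
  (sym (ℚP.*-distribˡ-+ k _ _))

⋆-sucʳ : ∀ a b n → (a ⋆ b) (suc n) ≡ (a ⋆ b ∘ suc) n + a (suc n) * b 0
⋆-sucʳ a b zero = refl
⋆-sucʳ a b (suc n) = trans (cong (_+_ (a 0 * b (suc (suc n)))) (⋆-sucʳ (a ∘ suc) b n))
  (sym (ℚP.+-assoc (a 0 * b (suc (suc n))) _ _))

⋆-comm : ∀ a b → a ⋆ b ≗ b ⋆ a
⋆-comm a b zero = ℚP.*-comm (a 0) (b 0)
⋆-comm a b (suc n) = begin
  a 0 * b (suc n) + (a ∘ suc ⋆ b) n   ≡⟨ cong (_+_ (a 0 * b (suc n))) (⋆-comm (a ∘ suc) b n) ⟩
  a 0 * b (suc n) + (b ⋆ a ∘ suc) n   ≡⟨ ℚP.+-comm (a 0 * b (suc n)) _ ⟩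
  (b ⋆ a ∘ suc) n + a 0 * b (suc n)   ≡⟨ cong (_+_ ((b ⋆ a ∘ suc) n)) (ℚP.*-comm (a 0) (b (suc n))) ⟩
  (b ⋆ a ∘ suc) n + b (suc n) * a 0   ≡⟨ sym (⋆-sucʳ b a n) ⟩
  (b ⋆ a) (suc n)                     ∎
  where open ≡-Reasoning

⋆-identityʳ : ∀ a → a ⋆ 𝟙 ≗ a
⋆-identityʳ a n = trans (⋆-comm a 𝟙 n) (⋆-identityˡ a n)

⋆-assoc : ∀ a b c → (a ⋆ b) ⋆ c ≗ a ⋆ (b ⋆ c)
⋆-assoc a b c zero = ℚP.*-assoc (a 0) (b 0) (c 0)
⋆-assoc a b c (suc n) = begin
  (a ⋆ b) 0 * c (suc n) + ((a 0 · b ∘ suc ⊕ a ∘ suc ⋆ b) ⋆ c) n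
    ≡⟨ cong (_+_ ((a ⋆ b) 0 * c (suc n))) (⋆-distribʳ (a 0 · b ∘ suc) (a ∘ suc ⋆ b) c n) ⟩
  (a ⋆ b) 0 * c (suc n) + (((a 0 · b ∘ suc) ⋆ c) n + ((a ∘ suc ⋆ b) ⋆ c) n)
    ≡⟨ cong₂ (λ u v → (a ⋆ b) 0 * c (suc n) + (u + v))
             (·-⋆-assoc (a 0) (b ∘ suc) c n) (⋆-assoc (a ∘ suc) b c n) ⟩
  (a 0 * b 0) * c (suc n) + (a 0 * (b ∘ suc ⋆ c) n + (a ∘ suc ⋆ (b ⋆ c)) n)
    ≡⟨ solve 5 (λ a₀ b₀ c₁ m r → (a₀ :* b₀) :* c₁ :+ (a₀ :* m :+ r) := a₀ :* (b₀ :* c₁ :+ m) :+ r)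
             refl (a 0) (b 0) (c (suc n)) _ _ ⟩
  a 0 * (b ⋆ c) (suc n) + (a ∘ suc ⋆ (b ⋆ c)) n
    ∎
  where open ≡-Reasoning

⋆-shift : ∀ a b n → (a ⋆ shift b) (suc n) ≡ (a ⋆ b) n
⋆-shift a b n = trans (cong (_+_ (a 0 * b n)) (⋆-shift′ n)) (lemma n)
  where
  ⋆-shift′ : ∀ n → (a ∘ suc ⋆ shift b) n ≡ shift (a ∘ suc ⋆ b) n
  ⋆-shift′ zero = ℚP.*-zeroʳ (a 1)
  ⋆-shift′ (suc n) = ⋆-shift (a ∘ suc) b n
  lemma : ∀ n → a 0 * b n + shift (a ∘ suc ⋆ b) n ≡ (a ⋆ b) n
  lemma zero = ℚP.+-identityʳ (a 0 * b 0)
  lemma (suc n) = refl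

θ-𝟙 : θ 𝟙 ≗ 𝟘
θ-𝟙 zero = refl
θ-𝟙 (suc n) = ℚP.*-zeroʳ (ℕ→ℚ (suc n))

θ-suc : ∀ a → θ a ∘ suc ≗ θ (a ∘ suc) ⊕ a ∘ suc
θ-suc a k = trans (cong (_* a (suc k)) (ℕ→ℚ-+ 1 k))
  (solve 2 (λ K A → (con 1ℚ :+ K) :* A := K :* A :+ A) refl (ℕ→ℚ k) (a (suc k)))

θ-⋆ : ∀ a b → θ (a ⋆ b) ≗ θ a ⋆ b ⊕ a ⋆ θ b
θ-⋆ a b zero =
  solve 2 (λ p q → con 0ℚ :* (p :* q) := (con 0ℚ :* p) :* q :+ p :* (con 0ℚ :* q)) refl (a 0) (b 0)
θ-⋆ a b (suc n) = begin
  ℕ→ℚ (suc n) * (a 0 * b (suc n) + M)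
    ≡⟨ cong (_* (a 0 * b (suc n) + M)) (ℕ→ℚ-+ 1 n) ⟩
  (1ℚ + N) * (a 0 * b (suc n) + M)
    ≡⟨ solve 4 (λ N a₀ b₁ M → (con 1ℚ :+ N) :* (a₀ :* b₁ :+ M)
                              := con 0ℚ :* a₀ :* b₁ :+ (N :* M :+ M) :+ a₀ :* ((con 1ℚ :+ N) :* b₁))
             refl N (a 0) (b (suc n)) M ⟩
  0ℚ * a 0 * b (suc n) + (N * M + M) + a 0 * ((1ℚ + N) * b (suc n))
    ≡⟨ cong₂ (λ u v → 0ℚ * a 0 * b (suc n) + (u + M) + a 0 * (v * b (suc n)))
             (θ-⋆ (a ∘ suc) b n) (sym (ℕ→ℚ-+ 1 n)) ⟩
  0ℚ * a 0 * b (suc n) + (P + R + M) + a 0 * θ b (suc n)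
    ≡⟨ solve 5 (λ z P R M X → z :+ (P :+ R :+ M) :+ X := z :+ (P :+ M) :+ (X :+ R))
             refl (0ℚ * a 0 * b (suc n)) P R M (a 0 * θ b (suc n)) ⟩
  0ℚ * a 0 * b (suc n) + (P + M) + (a 0 * θ b (suc n) + R)
    ≡⟨ cong (λ u → 0ℚ * a 0 * b (suc n) + u + (a 0 * θ b (suc n) + R))
            (sym (trans (⋆-congˡ b (θ-suc a) n) (⋆-distribʳ (θ (a ∘ suc)) (a ∘ suc) b n))) ⟩
  (θ a ⋆ b) (suc n) + (a ⋆ θ b) (suc n)
    ∎
  where
  open ≡-Reasoning
  N M P R : ℚ
  N = ℕ→ℚ n
  M = (a ∘ suc ⋆ b) n
  P = (θ (a ∘ suc) ⋆ b) n
  R = (a ∘ suc ⋆ θ b) n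

θ-^ : ∀ a m → θ (a ^ suc m) ≗ ℕ→ℚ (suc m) · (a ^ m ⋆ θ a)
θ-^ a zero n = begin
  ℕ→ℚ n * (a ⋆ 𝟙) n   ≡⟨ cong (ℕ→ℚ n *_) (⋆-identityʳ a n) ⟩
  θ a n               ≡⟨ sym (⋆-identityˡ (θ a) n) ⟩
  (𝟙 ⋆ θ a) n         ≡⟨ sym (ℚP.*-identityˡ _) ⟩
  1ℚ * (𝟙 ⋆ θ a) n    ∎
  where open ≡-Reasoning
θ-^ a (suc m) = begin
  θ (a ⋆ a ^ suc m)                             ≈⟨ θ-⋆ a (a ^ suc m) ⟩
  θ a ⋆ a ^ suc m ⊕ a ⋆ θ (a ^ suc m)           ≈⟨ (λ n → cong₂ _+_ (⋆-comm (θ a) (a ^ suc m) n) (IH n)) ⟩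
  a ^ suc m ⋆ θ a ⊕ M · (a ^ suc m ⋆ θ a)       ≈⟨ (λ n → add-one (a ^ suc m ⋆ θ a) n) ⟩
  ℕ→ℚ (suc (suc m)) · (a ^ suc m ⋆ θ a)        ∎
  where
  open ≈-Reasoning
  M : ℚ
  M = ℕ→ℚ (suc m)
  IH : a ⋆ θ (a ^ suc m) ≗ M · (a ^ suc m ⋆ θ a)
  IH n = trans (⋆-congʳ a (θ-^ a m) n)
          (trans (⋆-·-comm M a (a ^ m ⋆ θ a) n) (cong (M *_) (sym (⋆-assoc a (a ^ m) (θ a) n))))
  add-one : ∀ b → b ⊕ M · b ≗ ℕ→ℚ (suc (suc m)) · b
  add-one b n = trans (solve 2 (λ X M → X :+ M :* X := (con 1ℚ :+ M) :* X) refl (b n) M)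
                      (cong (_* b n) (sym (ℕ→ℚ-+ 1 (suc m))))

θ-geometric : ∀ F T → F ≗ 𝟙 ⊕ T ⋆ F → θ F ≗ F ⋆ F ⋆ θ T
θ-geometric F T F-eq n = begin
  θ F n                ≡⟨ ∙-cancelˡ Y (θ F n) B cancellable ⟩
  (F ⋆ (θ T ⋆ F)) n    ≡⟨ ⋆-congʳ F (⋆-comm (θ T) F) n ⟩
  (F ⋆ (F ⋆ θ T)) n    ≡⟨ sym (⋆-assoc F F (θ T) n) ⟩
  (F ⋆ F ⋆ θ T) n      ∎
  where
  open ≡-Reasoning
  θF-eq : θ F ≗ θ T ⋆ F ⊕ T ⋆ θ F
  θF-eq k = begin
    ℕ→ℚ k * F k                              ≡⟨ cong (ℕ→ℚ k *_) (F-eq k) ⟩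
    ℕ→ℚ k * (𝟙 k + (T ⋆ F) k)               ≡⟨ ℚP.*-distribˡ-+ (ℕ→ℚ k) (𝟙 k) _ ⟩
    θ 𝟙 k + θ (T ⋆ F) k                      ≡⟨ cong (_+ θ (T ⋆ F) k) (θ-𝟙 k) ⟩
    0ℚ + θ (T ⋆ F) k                         ≡⟨ ℚP.+-identityˡ _ ⟩
    θ (T ⋆ F) k                              ≡⟨ θ-⋆ T F k ⟩
    (θ T ⋆ F) k + (T ⋆ θ F) k                ∎
  F⋆T⊕𝟙 : F ⋆ T ⊕ 𝟙 ≗ F
  F⋆T⊕𝟙 k = trans (ℚP.+-comm ((F ⋆ T) k) (𝟙 k))
                  (trans (cong (_+_ (𝟙 k)) (⋆-comm F T k)) (sym (F-eq k)))
  Y B : ℚ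
  Y = (F ⋆ T ⋆ θ F) n
  B = (F ⋆ (θ T ⋆ F)) n
  -- Multiply θF = θT F + T θF by F and use F T = F − 1.
  cancellable : Y + θ F n ≡ Y + B
  cancellable = begin
    Y + θ F n                                ≡⟨ cong (_+_ Y) (sym (⋆-identityˡ (θ F) n)) ⟩
    Y + (𝟙 ⋆ θ F) n                          ≡⟨ sym (⋆-distribʳ (F ⋆ T) 𝟙 (θ F) n) ⟩
    ((F ⋆ T ⊕ 𝟙) ⋆ θ F) n                    ≡⟨ ⋆-congˡ (θ F) F⋆T⊕𝟙 n ⟩
    (F ⋆ θ F) n                              ≡⟨ ⋆-congʳ F θF-eq n ⟩
    (F ⋆ (θ T ⋆ F ⊕ T ⋆ θ F)) n              ≡⟨ ⋆-distribˡ F (θ T ⋆ F) (T ⋆ θ F) n ⟩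
    B + (F ⋆ (T ⋆ θ F)) n                    ≡⟨ cong (_+_ B) (sym (⋆-assoc F T (θ F) n)) ⟩
    B + Y                                    ≡⟨ ℚP.+-comm B Y ⟩
    Y + B                                    ∎

weight : ℚ → ℕ → ℚ
weight x k = x + (+ 1 / suc k)

treeSeries : ℚ → Series → Series
treeSeries x F zero = 0ℚ
treeSeries x F (suc k) = weight x k * F k

θ-treeSeries : ∀ x F → θ (treeSeries x F) ≗ (x + 1ℚ) · shift F ⊕ x · shift (θ F)
θ-treeSeries x F zero =
  solve 1 (λ x → con 0ℚ :* con 0ℚ := (x :+ con 1ℚ) :* con 0ℚ :+ x :* con 0ℚ) refl x
θ-treeSeries x F (suc k) = begin
  ℕ→ℚ (suc k) * ((x + k⁻¹) * F k)
    ≡⟨ solve 4 (λ K x i f → K :* ((x :+ i) :* f) := (x :* K :+ i :* K) :* f) refl (ℕ→ℚ (suc k)) x k⁻¹ (F k) ⟩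
  (x * ℕ→ℚ (suc k) + k⁻¹ * ℕ→ℚ (suc k)) * F k
    ≡⟨ cong₂ (λ u v → (x * u + v) * F k) (ℕ→ℚ-+ 1 k) (1/-inverseˡ (suc k)) ⟩
  (x * (1ℚ + ℕ→ℚ k) + 1ℚ) * F k
    ≡⟨ solve 3 (λ x K f → (x :* (con 1ℚ :+ K) :+ con 1ℚ) :* f := (x :+ con 1ℚ) :* f :+ x :* (K :* f))
             refl x (ℕ→ℚ k) (F k) ⟩
  (x + 1ℚ) * F k + x * (ℕ→ℚ k * F k)
    ∎
  where
  open ≡-Reasoning
  k⁻¹ : ℚ
  k⁻¹ = + 1 / suc k

prodℚ-++ : ∀ xs ys → prodℚ (xs ++ ys) ≡ prodℚ xs * prodℚ ys
prodℚ-++ [] ys = sym (ℚP.*-identityˡ _)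
prodℚ-++ (q ∷ xs) ys = trans (cong (q *_) (prodℚ-++ xs ys)) (sym (ℚP.*-assoc q (prodℚ xs) (prodℚ ys)))

closedFactor : ℚ → ℕ → ℕ → ℚ
closedFactor x s i = ℕ→ℚ (s ∸ i) * x + ℕ→ℚ (s ∸ 2 ℕ.* i)

closedProduct : ℚ → ℕ → ℕ → ℚ
closedProduct x s n = prodℚ (map (closedFactor x s) (upTo n))

closedProduct-suc : ∀ x s n → closedProduct x s (suc n) ≡ closedProduct x s n * closedFactor x s n
closedProduct-suc x s n = begin
  prodℚ (map f (upTo (suc n)))               ≡⟨ cong (prodℚ ∘ map f) (sym (Listₚ.upTo-∷ʳ n)) ⟩
  prodℚ (map f (upTo n ++ [ n ]))            ≡⟨ cong prodℚ (Listₚ.map-++ f (upTo n) [ n ]) ⟩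
  prodℚ (map f (upTo n) ++ [ f n ])          ≡⟨ prodℚ-++ (map f (upTo n)) [ f n ] ⟩
  prodℚ (map f (upTo n)) * (f n * 1ℚ)        ≡⟨ cong (prodℚ (map f (upTo n)) *_) (ℚP.*-identityʳ (f n)) ⟩
  prodℚ (map f (upTo n)) * f n               ∎
  where
  open ≡-Reasoning
  f : ℕ → ℚ
  f = closedFactor x s

closedFactor-last : ∀ x t n → closedFactor x (t ℕ.+ 2 ℕ.* n) n ≡ ℕ→ℚ (t ℕ.+ n) * x + ℕ→ℚ t
closedFactor-last x t n = cong₂ (λ u v → ℕ→ℚ u * x + ℕ→ℚ v)
  (trans (cong (_∸ n) (split t n)) (ℕP.m+n∸n≡m (t ℕ.+ n) n))
  (ℕP.m+n∸n≡m t (2 ℕ.* n))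
  where
  split : ∀ t n → t ℕ.+ 2 ℕ.* n ≡ t ℕ.+ n ℕ.+ n
  split = solve-∀

module HookSeries (x : ℚ) (F : Series) (F-eq : F ≗ 𝟙 ⊕ treeSeries x F ⋆ F) where

  T : Series
  T = treeSeries x F

  ^-zero : ∀ m → (F ^ m) 0 ≡ 1ℚ
  ^-zero zero = refl
  ^-zero (suc m) = trans (cong₂ _*_ F-zero (^-zero m)) (ℚP.*-identityˡ 1ℚ)
    where
    F-zero : F 0 ≡ 1ℚ
    F-zero = trans (F-eq 0) (trans (cong (_+_ 1ℚ) (ℚP.*-zeroˡ (F 0))) (ℚP.+-identityʳ 1ℚ))

  ^⋆θ-suc : ∀ m n → (F ^ m ⋆ θ F) (suc n) ≡ (x + 1ℚ) * (F ^ (3 ℕ.+ m)) n + x * (F ^ (2 ℕ.+ m) ⋆ θ F) n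
  ^⋆θ-suc m n = begin
    (F ^ m ⋆ θ F) (suc n)
      ≡⟨ ⋆-congʳ (F ^ m) (θ-geometric F T F-eq) (suc n) ⟩
    (F ^ m ⋆ (F ⋆ F ⋆ θ T)) (suc n)
      ≡⟨ sym (⋆-assoc (F ^ m) (F ⋆ F) (θ T) (suc n)) ⟩
    (F ^ m ⋆ (F ⋆ F) ⋆ θ T) (suc n)
      ≡⟨ ⋆-congˡ (θ T) (λ k → trans (⋆-comm (F ^ m) (F ⋆ F) k) (⋆-assoc F F (F ^ m) k)) (suc n) ⟩
    (G ⋆ θ T) (suc n)
      ≡⟨ ⋆-congʳ G (θ-treeSeries x F) (suc n) ⟩
    (G ⋆ ((x + 1ℚ) · shift F ⊕ x · shift (θ F))) (suc n)
      ≡⟨ ⋆-distribˡ G ((x + 1ℚ) · shift F) (x · shift (θ F)) (suc n) ⟩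
    (G ⋆ (x + 1ℚ) · shift F) (suc n) + (G ⋆ x · shift (θ F)) (suc n)
      ≡⟨ cong₂ _+_ (⋆-·-comm (x + 1ℚ) G (shift F) (suc n)) (⋆-·-comm x G (shift (θ F)) (suc n)) ⟩
    (x + 1ℚ) * (G ⋆ shift F) (suc n) + x * (G ⋆ shift (θ F)) (suc n)
      ≡⟨ cong₂ (λ u v → (x + 1ℚ) * u + x * v) (trans (⋆-shift G F n) (⋆-comm G F n)) (⋆-shift G (θ F) n) ⟩
    (x + 1ℚ) * (F ^ (3 ℕ.+ m)) n + x * (G ⋆ θ F) n
      ∎
    where
    open ≡-Reasoning
    G : Series
    G = F ^ (2 ℕ.+ m)

  ^-recurrence : ∀ m n → ℕ→ℚ (suc n) * (F ^ suc m) (suc n)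
                       ≡ ℕ→ℚ (suc m) * ((x + 1ℚ) * (F ^ (3 ℕ.+ m)) n + x * (F ^ (2 ℕ.+ m) ⋆ θ F) n)
  ^-recurrence m n = trans (θ-^ F m (suc n)) (cong (ℕ→ℚ (suc m) *_) (^⋆θ-suc m n))

  closed-form : ∀ n m → ℕ→ℚ (suc m ℕ.+ 2 ℕ.* n) * ℕ→ℚ (n !) * (F ^ suc m) n
                        ≡ ℕ→ℚ (suc m) * closedProduct x (suc m ℕ.+ 2 ℕ.* n) n
  closed-form zero m = begin
    ℕ→ℚ (suc m ℕ.+ 0) * ℕ→ℚ 1 * (F ^ suc m) 0
      ≡⟨ cong₂ (λ s f → ℕ→ℚ s * ℕ→ℚ 1 * f) (ℕP.+-identityʳ (suc m)) (^-zero (suc m)) ⟩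
    ℕ→ℚ (suc m) * 1ℚ * 1ℚ
      ≡⟨ ℚP.*-identityʳ _ ⟩
    ℕ→ℚ (suc m) * 1ℚ
      ∎
    where open ≡-Reasoning
  closed-form (suc n) m = begin
    ℕ→ℚ (suc m ℕ.+ 2 ℕ.* suc n) * ℕ→ℚ (suc n !) * (F ^ suc m) (suc n)
      ≡⟨ cong₂ (λ s f → ℕ→ℚ s * f * (F ^ suc m) (suc n)) size-eq (ℕ→ℚ-* (suc n) (n !)) ⟩
    A * (ℕ→ℚ (suc n) * B) * (F ^ suc m) (suc n)
      ≡⟨ solve 4 (λ A N B Q → A :* (N :* B) :* Q := A :* B :* (N :* Q))
               refl A (ℕ→ℚ (suc n)) B ((F ^ suc m) (suc n)) ⟩
    A * B * (ℕ→ℚ (suc n) * (F ^ suc m) (suc n))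
      ≡⟨ cong (A * B *_) (^-recurrence m n) ⟩
    A * B * (M₁ * ((x + 1ℚ) * Q₃ + x * W₃))
      ≡⟨ solve 6 (λ A B M₁ x Q W → A :* B :* (M₁ :* ((x :+ con 1ℚ) :* Q :+ x :* W))
                                  := M₁ :* ((x :+ con 1ℚ) :* (A :* B :* Q) :+ x :* (A :* B :* W)))
               refl A B M₁ x Q₃ W₃ ⟩
    M₁ * ((x + 1ℚ) * (A * B * Q₃) + x * (A * B * W₃))
      ≡⟨ cong₂ (λ u v → M₁ * ((x + 1ℚ) * u + x * v)) IH W-closed ⟩
    M₁ * ((x + 1ℚ) * (M₃ * P) + x * (N * P))
      ≡⟨ solve 5 (λ M₁ x M₃ P N → M₁ :* ((x :+ con 1ℚ) :* (M₃ :* P) :+ x :* (N :* P))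
                                 := M₁ :* (P :* ((M₃ :+ N) :* x :+ M₃)))
               refl M₁ x M₃ P N ⟩
    M₁ * (P * ((M₃ + N) * x + M₃))
      ≡⟨ cong (M₁ *_) (sym product-eq) ⟩
    M₁ * closedProduct x (suc m ℕ.+ 2 ℕ.* suc n) (suc n)
      ∎
    where
    open ≡-Reasoning
    s : ℕ
    s = 3 ℕ.+ m ℕ.+ 2 ℕ.* n
    size-eq : suc m ℕ.+ 2 ℕ.* suc n ≡ s
    size-eq = arith m n
      where
      arith : ∀ m n → suc m ℕ.+ 2 ℕ.* suc n ≡ 3 ℕ.+ m ℕ.+ 2 ℕ.* n
      arith = solve-∀
    A B N M₁ M₃ Q₃ W₃ P : ℚ
    A = ℕ→ℚ s
    B = ℕ→ℚ (n !)
    N = ℕ→ℚ n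
    M₁ = ℕ→ℚ (suc m)
    M₃ = ℕ→ℚ (3 ℕ.+ m)
    Q₃ = (F ^ (3 ℕ.+ m)) n
    W₃ = (F ^ (2 ℕ.+ m) ⋆ θ F) n
    P = closedProduct x s n
    IH : A * B * Q₃ ≡ M₃ * P
    IH = closed-form n (2 ℕ.+ m)
    W-closed : A * B * W₃ ≡ N * P
    W-closed = ℕ→ℚ-suc-cancelˡ (2 ℕ.+ m) (begin
      M₃ * (A * B * W₃)   ≡⟨ solve 4 (λ M A B W → M :* (A :* B :* W) := A :* B :* (M :* W)) refl M₃ A B W₃ ⟩
      A * B * (M₃ * W₃)   ≡⟨ cong (A * B *_) (sym (θ-^ F (2 ℕ.+ m) n)) ⟩
      A * B * (N * Q₃)    ≡⟨ solve 4 (λ N A B Q → A :* B :* (N :* Q) := N :* (A :* B :* Q)) refl N A B Q₃ ⟩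
      N * (A * B * Q₃)    ≡⟨ cong (N *_) IH ⟩
      N * (M₃ * P)        ≡⟨ solve 3 (λ N M P → N :* (M :* P) := M :* (N :* P)) refl N M₃ P ⟩
      M₃ * (N * P)        ∎)
    product-eq : closedProduct x (suc m ℕ.+ 2 ℕ.* suc n) (suc n) ≡ P * ((M₃ + N) * x + M₃)
    product-eq = begin
      closedProduct x (suc m ℕ.+ 2 ℕ.* suc n) (suc n)   ≡⟨ cong (λ t → closedProduct x t (suc n)) size-eq ⟩
      closedProduct x s (suc n)                         ≡⟨ closedProduct-suc x s n ⟩
      P * closedFactor x s n                            ≡⟨ cong (P *_) (closedFactor-last x (3 ℕ.+ m) n) ⟩
      P * (ℕ→ℚ (3 ℕ.+ m ℕ.+ n) * x + M₃)                ≡⟨ cong (λ u → P * (u * x + M₃)) (ℕ→ℚ-+ (3 ℕ.+ m) n) ⟩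
      P * ((M₃ + N) * x + M₃)                           ∎

  coefficients : ∀ n → F n ≡ rhs n x
  coefficients n = begin
    F n                        ≡⟨ sym (ℚP.*-identityˡ (F n)) ⟩
    1ℚ * F n                   ≡⟨ cong (_* F n) (sym (1/-inverseˡ d {{d≢0}})) ⟩
    coeff n * ℕ→ℚ d * F n      ≡⟨ ℚP.*-assoc (coeff n) (ℕ→ℚ d) (F n) ⟩
    coeff n * (ℕ→ℚ d * F n)    ≡⟨ cong (coeff n *_) scaled ⟩
    rhs n x                    ∎
    where
    open ≡-Reasoning
    d : ℕ
    d = suc (2 ℕ.* n) ℕ.* n !
    d≢0 : ℕ.NonZero d
    d≢0 = ℕP.m*n≢0 (suc (2 ℕ.* n)) (n !) {{_}} {{ℕP._!≢0 n}}
    scaled : ℕ→ℚ d * F n ≡ closedProduct x (suc (2 ℕ.* n)) n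
    scaled = begin
      ℕ→ℚ d * F n                                      ≡⟨ cong₂ _*_ (ℕ→ℚ-* (suc (2 ℕ.* n)) (n !))
                                                                    (sym (⋆-identityʳ F n)) ⟩
      ℕ→ℚ (suc (2 ℕ.* n)) * ℕ→ℚ (n !) * (F ^ 1) n     ≡⟨ closed-form n 0 ⟩
      1ℚ * closedProduct x (suc (2 ℕ.* n)) n           ≡⟨ ℚP.*-identityˡ _ ⟩
      closedProduct x (suc (2 ℕ.* n)) n                ∎

sumℚ-++ : ∀ xs ys → sumℚ (xs ++ ys) ≡ sumℚ xs + sumℚ ys
sumℚ-++ [] ys = sym (ℚP.+-identityˡ _)
sumℚ-++ (q ∷ xs) ys = trans (cong (_+_ q) (sumℚ-++ xs ys)) (sym (ℚP.+-assoc q (sumℚ xs) (sumℚ ys)))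

sumℚ-map-scale : ∀ {A : Set} (c : ℚ) (g h : A → ℚ) {xs} → All (λ a → g a ≡ c * h a) xs →
                 sumℚ (map g xs) ≡ c * sumℚ (map h xs)
sumℚ-map-scale c g h [] = sym (ℚP.*-zeroʳ c)
sumℚ-map-scale c g h {a ∷ xs} (ga ∷ gxs) =
  trans (cong₂ _+_ ga (sumℚ-map-scale c g h gxs)) (sym (ℚP.*-distribˡ-+ c (h a) _))

sumℚ-↭ : ∀ {xs ys} → xs ↭ ys → sumℚ xs ≡ sumℚ ys
sumℚ-↭ {xs} {ys} p =
  trans (sumℚ≡foldr xs) (trans (foldr-commMonoid setoid isCommutativeMonoid (↭⇒↭ₛ p)) (sym (sumℚ≡foldr ys)))
  where
  open CommutativeMonoid ℚP.+-0-commutativeMonoid using (setoid; isCommutativeMonoid)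
  sumℚ≡foldr : ∀ xs → sumℚ xs ≡ foldr _+_ 0ℚ xs
  sumℚ≡foldr [] = refl
  sumℚ≡foldr (q ∷ xs) = cong (_+_ q) (sumℚ≡foldr xs)

sumℚ-map-unique : ∀ {A : Set} (h : A → ℚ) {xs ys} → Unique xs → Unique ys →
                  (∀ {z} → z ∈ xs ⇔ z ∈ ys) → sumℚ (map h xs) ≡ sumℚ (map h ys)
sumℚ-map-unique h uxs uys xs⇔ys = sumℚ-↭ (↭ₚ.map⁺ h (∼bag⇒↭ (unique∧set⇒bag uxs uys xs⇔ys)))

module _ {A B C : Set} (f : A → B → C) where

  sumℚ-cartesianProductWith : ∀ (h : C → ℚ) (g : A → ℚ) (k : B → ℚ) → (∀ a b → h (f a b) ≡ g a * k b) →
    ∀ as bs → sumℚ (map h (cartesianProductWith f as bs)) ≡ sumℚ (map g as) * sumℚ (map k bs)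
  sumℚ-cartesianProductWith h g k h-f [] bs = sym (ℚP.*-zeroˡ (sumℚ (map k bs)))
  sumℚ-cartesianProductWith h g k h-f (a ∷ as) bs = begin
    sumℚ (map h (map (f a) bs ++ cartesianProductWith f as bs))
      ≡⟨ cong sumℚ (Listₚ.map-++ h (map (f a) bs) _) ⟩
    sumℚ (map h (map (f a) bs) ++ map h (cartesianProductWith f as bs))
      ≡⟨ sumℚ-++ (map h (map (f a) bs)) _ ⟩
    sumℚ (map h (map (f a) bs)) + sumℚ (map h (cartesianProductWith f as bs))
      ≡⟨ cong₂ _+_ (trans (cong sumℚ (sym (Listₚ.map-∘ bs)))
                          (sumℚ-map-scale (g a) (h ∘ f a) k {bs} (All.tabulate (λ {b} _ → h-f a b))))
                   (sumℚ-cartesianProductWith h g k h-f as bs) ⟩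
    g a * sumℚ (map k bs) + sumℚ (map g as) * sumℚ (map k bs)
      ≡⟨ sym (ℚP.*-distribʳ-+ (sumℚ (map k bs)) (g a) _) ⟩
    (g a + sumℚ (map g as)) * sumℚ (map k bs)
      ∎
    where open ≡-Reasoning

  -- The analogue of _⋆_ for list-valued sequences, with the same recursion.
  convolve : (ℕ → List A) → (ℕ → List B) → ℕ → List C
  convolve as bs zero = cartesianProductWith f (as 0) (bs 0)
  convolve as bs (suc n) = cartesianProductWith f (as 0) (bs (suc n)) ++ convolve (as ∘ suc) bs n

  sumℚ-convolve : ∀ (h : C → ℚ) (g : A → ℚ) (k : B → ℚ) → (∀ a b → h (f a b) ≡ g a * k b) →
    ∀ as bs n → sumℚ (map h (convolve as bs n))
                ≡ ((λ i → sumℚ (map g (as i))) ⋆ (λ j → sumℚ (map k (bs j)))) n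
  sumℚ-convolve h g k h-f as bs zero = sumℚ-cartesianProductWith h g k h-f (as 0) (bs 0)
  sumℚ-convolve h g k h-f as bs (suc n) = begin
    sumℚ (map h (cartesianProductWith f (as 0) (bs (suc n)) ++ convolve (as ∘ suc) bs n))
      ≡⟨ cong sumℚ (Listₚ.map-++ h (cartesianProductWith f (as 0) (bs (suc n))) _) ⟩
    sumℚ (map h (cartesianProductWith f (as 0) (bs (suc n))) ++ map h (convolve (as ∘ suc) bs n))
      ≡⟨ sumℚ-++ (map h (cartesianProductWith f (as 0) (bs (suc n)))) _ ⟩
    sumℚ (map h (cartesianProductWith f (as 0) (bs (suc n)))) + sumℚ (map h (convolve (as ∘ suc) bs n))
      ≡⟨ cong₂ _+_ (sumℚ-cartesianProductWith h g k h-f (as 0) (bs (suc n)))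
                   (sumℚ-convolve h g k h-f (as ∘ suc) bs n) ⟩
    ((λ i → sumℚ (map g (as i))) ⋆ (λ j → sumℚ (map k (bs j)))) (suc n)
      ∎
    where open ≡-Reasoning

  ∈-convolve⁺ : ∀ as bs {i j a b} → a ∈ as i → b ∈ bs j → f a b ∈ convolve as bs (i ℕ.+ j)
  ∈-convolve⁺ as bs {zero} {zero} a∈ b∈ = ∈-cartesianProductWith⁺ f a∈ b∈
  ∈-convolve⁺ as bs {zero} {suc j} a∈ b∈ = ∈-++⁺ˡ (∈-cartesianProductWith⁺ f a∈ b∈)
  ∈-convolve⁺ as bs {suc i} a∈ b∈ =
    ∈-++⁺ʳ (cartesianProductWith f (as 0) (bs (suc _))) (∈-convolve⁺ (as ∘ suc) bs a∈ b∈)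

  ∈-convolve⁻ : ∀ as bs n {c} → c ∈ convolve as bs n →
    ∃₂ λ i j → i ℕ.+ j ≡ n × ∃₂ λ a b → a ∈ as i × b ∈ bs j × c ≡ f a b
  ∈-convolve⁻ as bs zero c∈ = 0 , 0 , refl , ∈-cartesianProductWith⁻ f (as 0) (bs 0) c∈
  ∈-convolve⁻ as bs (suc n) c∈ with ∈-++⁻ (cartesianProductWith f (as 0) (bs (suc n))) c∈
  ... | inj₁ c∈₀ = 0 , suc n , refl , ∈-cartesianProductWith⁻ f (as 0) (bs (suc n)) c∈₀
  ... | inj₂ c∈₁ with ∈-convolve⁻ (as ∘ suc) bs n c∈₁
  ...   | i , j , i+j≡n , rest = suc i , j , cong suc i+j≡n , rest

  convolve-unique : (∀ {a a′ b b′} → f a b ≡ f a′ b′ → a ≡ a′ × b ≡ b′) →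
    ∀ as bs → (∀ i → Unique (as i)) → (∀ j → Unique (bs j)) →
    (∀ {i i′ a} → a ∈ as i → a ∈ as i′ → i ≡ i′) → ∀ n → Unique (convolve as bs n)
  convolve-unique f-inj as bs uas ubs disjoint zero =
    Uniqueₚ.cartesianProductWith⁺ f f-inj (uas 0) (ubs 0)
  convolve-unique f-inj as bs uas ubs disjoint (suc n) = Uniqueₚ.++⁺
    (Uniqueₚ.cartesianProductWith⁺ f f-inj (uas 0) (ubs (suc n)))
    (convolve-unique f-inj (as ∘ suc) bs (uas ∘ suc) ubs (λ p q → ℕP.suc-injective (disjoint p q)) n)
    separated
    where
    separated : Disjoint (cartesianProductWith f (as 0) (bs (suc n))) (convolve (as ∘ suc) bs n)
    separated (c∈₀ , c∈₁)
      with _ , _ , a∈ , _ , refl ← ∈-cartesianProductWith⁻ f (as 0) (bs (suc n)) c∈₀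
         | _ , _ , _ , _ , _ , a′∈ , _ , c≡ ← ∈-convolve⁻ (as ∘ suc) bs n c∈₁
      with () ← disjoint a∈ (subst (_∈ as _) (sym (proj₁ (f-inj c≡))) a′∈)

-- forests fuel n lists the forests with n vertices provided n ≤ fuel: a forest with n + 1
-- vertices is a tree node fs with |fs| = i followed by a forest with j vertices, i + j ≡ n.
forests : ℕ → ℕ → List Forest
forests _ zero = [ [] ]
forests zero (suc n) = []
forests (suc fuel) (suc n) = convolve _∷_ (map node ∘ forests fuel) (forests fuel) n

node-injective : ∀ {ts ts′} → node ts ≡ node ts′ → ts ≡ ts′
node-injective refl = refl

forests-sound : ∀ fuel n {F} → F ∈ forests fuel n → forestSize F ≡ n
forests-sound fuel zero (here refl) = refl
forests-sound (suc fuel) (suc n) F∈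
  with i , j , refl , t , rest , t∈ , rest∈ , refl
         ← ∈-convolve⁻ _∷_ (map node ∘ forests fuel) (forests fuel) n F∈
  with ts , ts∈ , refl ← ∈-map⁻ node t∈
  = cong₂ (λ u v → suc (u ℕ.+ v)) (forests-sound fuel i ts∈) (forests-sound fuel j rest∈)

forests-complete : ∀ fuel F → forestSize F ≤ fuel → F ∈ forests fuel (forestSize F)
forests-complete fuel [] _ = here refl
forests-complete (suc fuel) (node ts ∷ rest) (s≤s size≤fuel) =
  ∈-convolve⁺ _∷_ (map node ∘ forests fuel) (forests fuel) {forestSize ts} {forestSize rest}
  (∈-map⁺ node (forests-complete fuel ts (ℕP.≤-trans (ℕP.m≤m+n _ _) size≤fuel)))
  (forests-complete fuel rest (ℕP.≤-trans (ℕP.m≤n+m _ _) size≤fuel))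

forests-unique : ∀ fuel n → Unique (forests fuel n)
forests-unique fuel zero = [] AllPairs.∷ AllPairs.[]
forests-unique zero (suc n) = AllPairs.[]
forests-unique (suc fuel) (suc n) = convolve-unique _∷_ Listₚ.∷-injective
  (map node ∘ forests fuel) (forests fuel)
  (λ i → Uniqueₚ.map⁺ node-injective (forests-unique fuel i)) (forests-unique fuel)
  size-determined n
  where
  size-determined : ∀ {i i′ t} → t ∈ map node (forests fuel i) → t ∈ map node (forests fuel i′) → i ≡ i′
  size-determined {i} {i′} t∈ t∈′
    with ts , ts∈ , refl ← ∈-map⁻ node t∈
       | ts′ , ts′∈ , eq ← ∈-map⁻ node t∈′
    with refl ← node-injective eq
    = trans (sym (forests-sound fuel i ts∈)) (forests-sound fuel i′ ts′∈)

sumℚ-forests : ∀ (h : Forest → ℚ) {n fuel L} → n ≤ fuel → Unique L →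
               (∀ F → F ∈ L ⇔ forestSize F ≡ n) → sumℚ (map h L) ≡ sumℚ (map h (forests fuel n))
sumℚ-forests h {n} {fuel} n≤fuel uL L⇔ = sumℚ-map-unique h uL (forests-unique fuel n)
  (λ {F} → mk⇔ (λ F∈ → forests-complete′ (Equivalence.to (L⇔ F) F∈))
               (λ F∈ → Equivalence.from (L⇔ F) (forests-sound fuel n F∈)))
  where
  forests-complete′ : ∀ {F} → forestSize F ≡ n → F ∈ forests fuel n
  forests-complete′ {F} refl = forests-complete fuel F n≤fuel

hookSum : ℚ → Series
hookSum x n = sumℚ (map (forestHookProd x) (forests n n))

hookSum-eq : ∀ x → hookSum x ≗ 𝟙 ⊕ treeSeries x (hookSum x) ⋆ hookSum x
hookSum-eq x zero = cong (_+_ 1ℚ) (sym (ℚP.*-zeroˡ (hookSum x 0)))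
hookSum-eq x (suc n) = begin
  sumℚ (map (forestHookProd x) (convolve _∷_ (map node ∘ forests n) (forests n) n))
    ≡⟨ sumℚ-convolve _∷_ (forestHookProd x) (treeHookProd x) (forestHookProd x) (λ _ _ → refl)
                     (map node ∘ forests n) (forests n) n ⟩
  ((λ i → sumℚ (map (treeHookProd x) (map node (forests n i))))
     ⋆ (λ j → sumℚ (map (forestHookProd x) (forests n j)))) n
    ≡⟨ ⋆-cong-≤ n trees-sum (λ j j≤n → sym (forests-sum j j≤n)) ⟩
  (T ∘ suc ⋆ hookSum x) n
    ≡⟨ sym (trans (cong (λ u → 0ℚ + (u + (T ∘ suc ⋆ hookSum x) n)) (ℚP.*-zeroˡ (hookSum x (suc n))))
                  (trans (ℚP.+-identityˡ _) (ℚP.+-identityˡ _))) ⟩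
  (𝟙 ⊕ T ⋆ hookSum x) (suc n)
    ∎
  where
  open ≡-Reasoning
  T : Series
  T = treeSeries x (hookSum x)
  forests-sum : ∀ i → i ≤ n → hookSum x i ≡ sumℚ (map (forestHookProd x) (forests n i))
  forests-sum i i≤n = sumℚ-forests (forestHookProd x) i≤n (forests-unique i i)
    (λ F → mk⇔ (forests-sound i i) (λ { refl → forests-complete i F ℕP.≤-refl }))
  trees-sum : ∀ i → i ≤ n → sumℚ (map (treeHookProd x) (map node (forests n i))) ≡ T (suc i)
  trees-sum i i≤n = begin
    sumℚ (map (treeHookProd x) (map node (forests n i)))
      ≡⟨ cong sumℚ (sym (Listₚ.map-∘ (forests n i))) ⟩
    sumℚ (map (treeHookProd x ∘ node) (forests n i))
      ≡⟨ sumℚ-map-scale (weight x i) (treeHookProd x ∘ node) (forestHookProd x)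
           (All.tabulate (λ {ts} ts∈ → cong (λ k → weight x k * forestHookProd x ts)
                                            (forests-sound n i ts∈))) ⟩
    weight x i * sumℚ (map (forestHookProd x) (forests n i))
      ≡⟨ cong (weight x i *_) (sym (forests-sum i i≤n)) ⟩
    T (suc i)
      ∎

corollary4p4 : (n : ℕ) (x : ℚ) (L : List Forest) → Unique L →
    ((F : Forest) → (F ∈ L) ⇔ (forestSize F ≡ n)) →
    sumℚ (map (forestHookProd x) L) ≡ rhs n x
corollary4p4 n x L uL L⇔ = begin
  sumℚ (map (forestHookProd x) L)   ≡⟨ sumℚ-forests (forestHookProd x) ℕP.≤-refl uL L⇔ ⟩
  hookSum x n                       ≡⟨ HookSeries.coefficients x (hookSum x) (hookSum-eq x) n ⟩
  rhs n x                           ∎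
  where open ≡-Reasoning
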